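{- Let $p \neq 3$ be a prime, let $\epsilon>0$ and let $n>0$ be an integer. If $\|p^n\|_{\log} \geq 3+\epsilon$, then $S_3(p^n) \geq n\,\epsilon \log_3 p$.
   Context: For a positive integer $m$, $\|m\|$ (the integer complexity of $m$) denotes the minimum number of occurrences of the constant $1$ in an arithmetic expression built only from the constant $1$, addition, multiplication and parentheses whose value is $m$. For $m>1$, the logarithmic complexity is $\|m\|_{\log} = \|m\|/\log_3 m$. For an integer base $q \ge 2$, $S_q(m)$ denotes the sum of the digits of the canonical base-$q$ representation of $m$.
   Formalization: The parameter ε ranges only over the positive rationals. -}

module Defs where

open import Data.Nat using (ℕ; zero; suc; _+_; _*_; _≤_; NonZero)
open import Data.Nat.DivMod using (_/_; _%_)
open import Data.Product using (Σ; _×_)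
open import Relation.Binary.PropositionalEquality using (_≡_)

data Expr : Set where
  one  : Expr
  _⊕_  : Expr → Expr → Expr
  _⊗_  : Expr → Expr → Expr

val : Expr → ℕ
val one     = 1
val (e ⊕ f) = val e + val f
val (e ⊗ f) = val e * val f

ones : Expr → ℕ
ones one     = 1
ones (e ⊕ f) = ones e + ones f
ones (e ⊗ f) = ones e + ones f

IntComplexity : ℕ → ℕ → Set
IntComplexity m k =
  Σ Expr (λ e → val e ≡ m × ones e ≡ k) × (∀ (e : Expr) → val e ≡ m → k ≤ ones e)

-- digit sum in base q, with fuel (fuel m suffices since m / q < m)
digitSumAux : (q : ℕ) → .{{NonZero q}} → ℕ → ℕ → ℕ
digitSumAux q zero       m       = 0
digitSumAux q (suc fuel) zero    = 0
digitSumAux q (suc fuel) (suc m) = (suc m % q) + digitSumAux q fuel (suc m / q)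

S : (q : ℕ) → .{{NonZero q}} → ℕ → ℕ
S q m = digitSumAux q m m

{-# OPTIONS --safe #-}
-- Horner's scheme m = d₀ + 3 · (d₁ + 3 · (⋯ + 3 · d_L)) with ternary digits dᵢ, each 3 written as
-- 1 + 1 + 1 and each digit d as d ones, expresses m with at most 3 L + S₃(m) ones, where
-- 3 ^ L ≤ m.  Hence ‖m‖ ≤ 3 log₃ m + S₃(m), and ‖m‖ ≥ (3 + ε) log₃ m forces S₃(m) ≥ ε log₃ m.
module Submission where

open import Defs
open import Data.Nat using (ℕ; zero; suc; _+_; _*_; _^_; _≤_; _<_; z≤n; s≤s; NonZero)
open import Data.Nat.Properties
open import Data.Nat.DivMod using (_/_; _%_; m/n<m; m≡m%n+[m/n]*n)
open import Data.Nat.Primality using (Prime)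
open import Data.Nat.Tactic.RingSolver using (solve-∀)
open import Data.Product using (Σ-syntax; _×_; _,_)
open import Relation.Binary.PropositionalEquality

infixl 6 _+ones_

_+ones_ : Expr → ℕ → Expr
e +ones zero  = e
e +ones suc r = (e +ones r) ⊕ one

val-+ones : ∀ e r → val (e +ones r) ≡ val e + r
val-+ones e zero    = sym (+-identityʳ (val e))
val-+ones e (suc r) = begin
  val (e +ones r) + 1 ≡⟨ cong (_+ 1) (val-+ones e r) ⟩
  val e + r + 1       ≡⟨ +-assoc (val e) r 1 ⟩
  val e + (r + 1)     ≡⟨ cong (val e +_) (+-comm r 1) ⟩
  val e + suc r       ∎
  where open ≡-Reasoning

ones-+ones : ∀ e r → ones (e +ones r) ≡ ones e + r
ones-+ones e zero    = sym (+-identityʳ (ones e))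
ones-+ones e (suc r) = begin
  ones (e +ones r) + 1 ≡⟨ cong (_+ 1) (ones-+ones e r) ⟩
  ones e + r + 1       ≡⟨ +-assoc (ones e) r 1 ⟩
  ones e + (r + 1)     ≡⟨ cong (ones e +_) (+-comm r 1) ⟩
  ones e + suc r       ∎
  where open ≡-Reasoning

three : Expr
three = (one ⊕ one) ⊕ one

record LogCostExpr (m D : ℕ) : Set where
  field
    L       : ℕ
    3^L≤m   : 3 ^ L ≤ m
    expr    : Expr
    val≡m   : val expr ≡ m
    ones≤   : ones expr ≤ 3 * L + D

leadingDigit : ∀ r D → LogCostExpr (suc r) (suc r + D)
leadingDigit r D = record
  { L     = 0
  ; 3^L≤m = s≤s z≤n
  ; expr  = one +ones r
  ; val≡m = val-+ones one r
  ; ones≤ = ≤-trans (≤-reflexive (ones-+ones one r)) (m≤m+n (suc r) D)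
  }

hornerStep : ∀ {m r q D} → m ≡ r + q * 3 → LogCostExpr q D → LogCostExpr m (r + D)
hornerStep {_} {r} {q} {D} refl c = record
  { L     = suc L
  ; 3^L≤m = begin
      3 * 3 ^ L ≤⟨ *-monoʳ-≤ 3 3^L≤m ⟩
      3 * q     ≡⟨ *-comm 3 q ⟩
      q * 3     ≤⟨ m≤n+m (q * 3) r ⟩
      r + q * 3 ∎
  ; expr  = (three ⊗ expr) +ones r
  ; val≡m = begin-equality
      val ((three ⊗ expr) +ones r) ≡⟨ val-+ones (three ⊗ expr) r ⟩
      3 * val expr + r             ≡⟨ cong (λ x → 3 * x + r) val≡m ⟩
      3 * q + r                    ≡⟨ cong (_+ r) (*-comm 3 q) ⟩
      q * 3 + r                    ≡⟨ +-comm (q * 3) r ⟩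
      r + q * 3                    ∎
  ; ones≤ = begin
      ones ((three ⊗ expr) +ones r) ≡⟨ ones-+ones (three ⊗ expr) r ⟩
      3 + ones expr + r             ≤⟨ +-monoˡ-≤ r (+-monoʳ-≤ 3 ones≤) ⟩
      3 + (3 * L + D) + r           ≡⟨ regroup L D r ⟩
      3 * suc L + (r + D)           ∎
  }
  where
  open LogCostExpr c
  open ≤-Reasoning
  regroup : ∀ L D r → 3 + (3 * L + D) + r ≡ 3 * suc L + (r + D)
  regroup = solve-∀

logCostExpr : ∀ fuel m → m < fuel → LogCostExpr (suc m) (digitSumAux 3 fuel (suc m))
logCostExpr (suc f) m (s≤s m≤f)
  with suc m / 3 | m≡m%n+[m/n]*n (suc m) 3 | m/n<m (suc m) 3 (s≤s (s≤s z≤n))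
... | zero   | m≡r+0 | _ rewrite sym (trans m≡r+0 (+-identityʳ (suc m % 3))) =
  leadingDigit m (digitSumAux 3 f 0)
... | suc q | m≡r+q*3 | q<m =
  hornerStep m≡r+q*3 (logCostExpr f q (<-≤-trans (≤-pred q<m) m≤f))

complexity≤3L+S₃ : ∀ {m k} → IntComplexity (suc m) k →
  Σ[ L ∈ ℕ ] 3 ^ L ≤ suc m × k ≤ 3 * L + S 3 (suc m)
complexity≤3L+S₃ {m} (_ , minimal) = L , 3^L≤m , ≤-trans (minimal expr val≡m) ones≤
  where open LogCostExpr (logCostExpr (suc m) m ≤-refl)

cancelLogBound : ∀ {b m L k s} c U V → .{{NonZero b}} → .{{NonZero m}} →
  b ^ L ≤ m → k ≤ c * L + s →
  m ^ (c * V + U) ≤ b ^ (V * k) → m ^ U ≤ b ^ (V * s)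
cancelLogBound {b} {m} {L} {k} {s} c U V b^L≤m k≤cL+s hyp =
  *-cancelˡ-≤ (m ^ (c * V)) {{m^n≢0 m (c * V)}} (begin
    m ^ (c * V) * m ^ U                ≡⟨ ^-distribˡ-+-* m (c * V) U ⟨
    m ^ (c * V + U)                    ≤⟨ hyp ⟩
    b ^ (V * k)                        ≤⟨ ^-monoʳ-≤ b (*-monoʳ-≤ V k≤cL+s) ⟩
    b ^ (V * (c * L + s))              ≡⟨ cong (b ^_) (regroup V c L s) ⟩
    b ^ (L * (c * V) + V * s)          ≡⟨ ^-distribˡ-+-* b (L * (c * V)) (V * s) ⟩
    b ^ (L * (c * V)) * b ^ (V * s)    ≡⟨ cong (_* b ^ (V * s)) (^-*-assoc b L (c * V)) ⟨
    (b ^ L) ^ (c * V) * b ^ (V * s)    ≤⟨ *-monoˡ-≤ (b ^ (V * s)) (^-monoˡ-≤ (c * V) b^L≤m) ⟩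
    m ^ (c * V) * b ^ (V * s)          ∎)
  where
  open ≤-Reasoning
  regroup : ∀ V c L s → V * (c * L + s) ≡ L * (c * V) + V * s
  regroup = solve-∀

digitSum-lowerBound : ∀ m {k} u v → IntComplexity m k →
  m ^ (3 * suc v + suc u) ≤ 3 ^ (suc v * k) → m ^ suc u ≤ 3 ^ (suc v * S 3 m)
digitSum-lowerBound zero    u v _     _   = z≤n
digitSum-lowerBound (suc m) u v ‖m‖≡k hyp
  with L , 3^L≤m , k≤3L+S₃ ← complexity≤3L+S₃ ‖m‖≡k
  = cancelLogBound {L = L} {s = S 3 (suc m)} 3 (suc u) (suc v) 3^L≤m k≤3L+S₃ hyp

theorem1 : ∀ (p n u v k : ℕ) → Prime p → p ≢ 3 → 0 < n →
    IntComplexity (p ^ n) k →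
    (p ^ n) ^ (3 * suc v + suc u) ≤ 3 ^ (suc v * k) →
    (p ^ n) ^ (suc u) ≤ 3 ^ (suc v * S 3 (p ^ n))
theorem1 p n u v k _ _ _ = digitSum-lowerBound (p ^ n) u v
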